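{- (a) For every $\lambda\in X$, $x(\lambda)\in\mathcal O$. (b) For every $k\in\mathbb Z$, $\Lambda_0+kn\mathbf m\in\mathcal O$.
   Context: Fix positive integers $m>n$. $X$: partitions $\lambda=(\lambda_1\ge\dots\ge\lambda_n\ge0)$ with $\lambda_1\le m$; $\lambda'_j=|\{k:\lambda_k\ge j\}|$. Elements of $\mathbb Z^{n|m}$ are $(a_1,\dots,a_n|b_1,\dots,b_m)=\sum a_i\epsilon_i-\sum b_j\delta_j$, with $(\Lambda,\epsilon_i-\delta_j)=a_i-b_j$. $x(\lambda)$ has $a_i=m(n-i)+n\lambda_{n+1-i}$, $b_j=n(j-1)+m\lambda'_j$; $\Lambda_0=x(\emptyset)=(m(n-1),\dots,m,0|0,n,\dots,n(m-1))$; $\mathbf m=(m,\dots,m|m,\dots,m)$. For $\alpha=\epsilon_i-\delta_j$: $v_\alpha=n\epsilon_i-m\delta_j$, $\Pi_\alpha=\{(\Lambda,\alpha)=0\}$, $\Pi_{ -\alpha}=\{(\Lambda,\alpha)=n-m\}$, $\tau_{\pm\alpha}(\Lambda)=\Lambda\pm v_\alpha$ on $\Pi_{\pm\alpha}$. $\mathcal O$ is the smallest subset of $\mathbb Z^{n|m}$ containing $\Lambda_0$ and closed under applying $\tau_{\pm\alpha}$ to its elements lying in $\Pi_{\pm\alpha}$, for all $\alpha=\epsilon_i-\delta_j$. -}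

module Defs where

open import Data.Nat as ℕ using (ℕ; zero; suc; _∸_; _≤?_)
open import Data.Integer as ℤ using (ℤ; +_; _+_; _-_; _*_)
open import Data.Fin using (Fin; toℕ; opposite; _≤_)
open import Data.Vec using (Vec; lookup; tabulate; updateAt; count; map)
open import Data.Product using (_×_; _,_; proj₁; proj₂)
open import Relation.Binary.PropositionalEquality using (_≡_)

-- An element (a₁,…,aₙ | b₁,…,bₘ) of ℤ^{n|m}, i.e. Σ aᵢ εᵢ − Σ bⱼ δⱼ.
-- Indices are 0-based: Fin n index i stands for the paper's index i+1.
Weight : ℕ → ℕ → Set
Weight n m = Vec ℤ n × Vec ℤ m

module _ (m n : ℕ) where

  -- (Λ, εᵢ − δⱼ) = aᵢ − bⱼ
  pair : Weight n m → Fin n → Fin m → ℤ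
  pair (a , b) i j = lookup a i - lookup b j

  -- τ_{α}(Λ) = Λ + v_α, v_α = n εᵢ − m δⱼ : aᵢ ↦ aᵢ + n, bⱼ ↦ bⱼ + m
  τ⁺ : Fin n → Fin m → Weight n m → Weight n m
  τ⁺ i j (a , b) = updateAt a i (λ x → x + + n) , updateAt b j (λ y → y + + m)

  τ⁻ : Fin n → Fin m → Weight n m → Weight n m
  τ⁻ i j (a , b) = updateAt a i (λ x → x - + n) , updateAt b j (λ y → y - + m)

  Λ₀ : Weight n m
  Λ₀ = tabulate (λ i → + (m ℕ.* (n ∸ suc (toℕ i))))
     , tabulate (λ j → + (n ℕ.* toℕ j))

  data 𝒪 : Weight n m → Set where
    base : 𝒪 Λ₀
    up   : ∀ {Λ} (i : Fin n) (j : Fin m) → 𝒪 Λ →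
           pair Λ i j ≡ + 0 → 𝒪 (τ⁺ i j Λ)
    down : ∀ {Λ} (i : Fin n) (j : Fin m) → 𝒪 Λ →
           pair Λ i j ≡ + n - + m → 𝒪 (τ⁻ i j Λ)

  record InX (λs : Vec ℕ n) : Set where
    field
      decreasing : ∀ (i k : Fin n) → i ≤ k → lookup λs k ℕ.≤ lookup λs i
      bounded    : ∀ (i : Fin n) → lookup λs i ℕ.≤ m

  -- λ'ⱼ = |{k : λₖ ≥ j}|  (paper index j = toℕ j0 + 1)
  conj : Vec ℕ n → Fin m → ℕ
  conj λs j = count (λ x → suc (toℕ j) ≤? x) λs

  -- x(λ): aᵢ = m(n−i) + n λ_{n+1−i},  bⱼ = n(j−1) + m λ'ⱼ
  xλ : Vec ℕ n → Weight n m
  xλ λs = tabulate (λ i → + (m ℕ.* (n ∸ suc (toℕ i)) ℕ.+ n ℕ.* lookup λs (opposite i)))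
        , tabulate (λ j → + (n ℕ.* toℕ j ℕ.+ m ℕ.* conj λs j))

  shiftΛ₀ : ℤ → Weight n m
  shiftΛ₀ k = map (λ x → x + k * + n * + m) (proj₁ Λ₀)
            , map (λ y → y + k * + n * + m) (proj₂ Λ₀)

-- Adding the box in row r and column j+1 (0-based row index) to a partition μ moves x(μ)
-- by τ_α with α = ε_{n−r} − δ_{j+1}: x(μ) lies on Π_α exactly because row r has j boxes and
-- column j+1 has r boxes. Filling λ row by row therefore reaches x(λ) from x(∅) = Λ₀.
-- Filling the full n × m rectangle reaches Λ₀ + n𝐦. Such chains of τ_α commute with translation
-- by multiples of 𝐦, and they can also be walked backwards inside 𝒪, since τ_α maps Π_α into
-- Π_{−α} and τ_{−α} undoes it there; hence every Λ₀ + kn𝐦 is reached.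

module Submission where

open import Defs
open import Data.Nat as ℕ using (ℕ; zero; suc; _∸_; _≤_; _<_; z≤n; s≤s; _≤?_)
import Data.Nat.Properties as ℕₚ
import Data.Nat.Tactic.RingSolver as ℕSolver
open import Data.Integer as ℤ using (ℤ; +_; -[1+_]; 0ℤ; 1ℤ; _+_; _-_; _*_)
import Data.Integer.Properties as ℤₚ
import Data.Integer.Tactic.RingSolver as ℤSolver
open import Data.Fin as Fin using (Fin; toℕ; opposite)
import Data.Fin.Properties as Finₚ
open import Data.Vec using (Vec; []; _∷_; lookup; tabulate; updateAt; map; replicate; count)
open import Data.Vec.Properties
open import Data.Bool using (true; false; if_then_else_)
open import Data.Product using (_×_; _,_; proj₁; proj₂; ∃₂)
open import Function using (id; _∘_)
open import Level using (0ℓ)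
open import Relation.Binary using (Rel; tri<; tri≈; tri>)
open import Relation.Binary.Construct.Closure.ReflexiveTransitive as Star using (Star; ε; _◅_; _◅◅_)
open import Relation.Binary.PropositionalEquality
open import Relation.Nullary using (¬_; yes; no; does; contradiction)
open import Relation.Unary using (Pred; Decidable)

module _ {a} {A : Set a} where

  lookup-extensionality : ∀ {k} {xs ys : Vec A k} → (∀ i → lookup xs i ≡ lookup ys i) → xs ≡ ys
  lookup-extensionality {xs = xs} {ys} eq =
    trans (sym (tabulate∘lookup xs)) (trans (tabulate-cong eq) (tabulate∘lookup ys))

  ≡-updateAt : ∀ {k} (xs ys : Vec A k) (i : Fin k) {f : A → A} →
               lookup ys i ≡ f (lookup xs i) →
               (∀ l → l ≢ i → lookup ys l ≡ lookup xs l) →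
               ys ≡ updateAt xs i f
  ≡-updateAt (x ∷ xs) (y ∷ ys) Fin.zero here elsewhere =
    cong₂ _∷_ here (lookup-extensionality λ l → elsewhere (Fin.suc l) λ ())
  ≡-updateAt (x ∷ xs) (y ∷ ys) (Fin.suc i) here elsewhere =
    cong₂ _∷_ (elsewhere Fin.zero λ ())
              (≡-updateAt xs ys i here λ l l≢i → elsewhere (Fin.suc l) (l≢i ∘ Finₚ.suc-injective))

module _ {a p} {A : Set a} {P : Pred A p} (P? : Decidable P) where

  count-updateAt-stable : ∀ {k} (xs : Vec A k) i {f : A → A} →
                          (P (lookup xs i) → P (f (lookup xs i))) →
                          (P (f (lookup xs i)) → P (lookup xs i)) →
                          count P? (updateAt xs i f) ≡ count P? xs
  count-updateAt-stable (x ∷ xs) Fin.zero {f} to from with P? x | P? (f x)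
  ... | yes _  | yes _  = refl
  ... | no _   | no _   = refl
  ... | yes px | no ¬q  = contradiction (to px) ¬q
  ... | no ¬px | yes q  = contradiction (from q) ¬px
  count-updateAt-stable (x ∷ xs) (Fin.suc i) to from =
    cong (if does (P? x) then suc else id) (count-updateAt-stable xs i to from)

  count-updateAt-enter : ∀ {k} (xs : Vec A k) i {f : A → A} →
                         ¬ P (lookup xs i) → P (f (lookup xs i)) →
                         count P? (updateAt xs i f) ≡ suc (count P? xs)
  count-updateAt-enter (x ∷ xs) Fin.zero {f} ¬px pfx with P? x | P? (f x)
  ... | yes px | _      = contradiction px ¬px
  ... | _      | no ¬q  = contradiction pfx ¬q
  ... | no _   | yes _  = refl
  count-updateAt-enter (x ∷ xs) (Fin.suc i) ¬px pfx with does (P? x)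
  ... | true  = cong suc (count-updateAt-enter xs i ¬px pfx)
  ... | false = count-updateAt-enter xs i ¬px pfx

  count-prefix : ∀ {k} (xs : Vec A k) {r} → r ≤ k →
                 (∀ i → P (lookup xs i) → toℕ i < r) →
                 (∀ i → toℕ i < r → P (lookup xs i)) →
                 count P? xs ≡ r
  count-prefix []       z≤n _ _ = refl
  count-prefix (x ∷ xs) {zero} _ only _ with P? x
  ... | yes px = contradiction (only Fin.zero px) λ ()
  ... | no _   = count-prefix xs z≤n (λ i pxi → contradiction (only (Fin.suc i) pxi) λ ()) λ _ ()
  count-prefix (x ∷ xs) {suc r} (s≤s r≤k) only all with P? x
  ... | yes _   = cong suc (count-prefix xs r≤k (λ i → ℕₚ.≤-pred ∘ only (Fin.suc i)) (λ i → all (Fin.suc i) ∘ s≤s))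
  ... | no ¬px  = contradiction (all Fin.zero (s≤s z≤n)) ¬px

ℤ-bi-induction : ∀ {p} (P : ℤ → Set p) → P 0ℤ →
                 (∀ k → P k → P (ℤ.suc k)) → (∀ k → P (ℤ.suc k) → P k) →
                 ∀ k → P k
ℤ-bi-induction P P0 fwd bwd (+ zero)        = P0
ℤ-bi-induction P P0 fwd bwd (+ suc k)       = fwd (+ k) (ℤ-bi-induction P P0 fwd bwd (+ k))
ℤ-bi-induction P P0 fwd bwd -[1+ zero ]     = bwd -[1+ 0 ] P0
ℤ-bi-induction P P0 fwd bwd -[1+ suc k ]    = bwd -[1+ suc k ] (ℤ-bi-induction P P0 fwd bwd -[1+ k ])

[x+c]-[y+d]≡[x-y]+[c-d] : ∀ x y c d → (x + c) - (y + d) ≡ (x - y) + (c - d)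
[x+c]-[y+d]≡[x-y]+[c-d] = ℤSolver.solve-∀

+-right-comm : ∀ x y z → x + y + z ≡ x + z + y
+-right-comm = ℤSolver.solve-∀

pos-+-*-suc : ∀ a b c → + (a ℕ.+ b ℕ.* suc c) ≡ + (a ℕ.+ b ℕ.* c) + + b
pos-+-*-suc a b c = trans (cong +_ (distrib a b c)) (ℤₚ.pos-+ (a ℕ.+ b ℕ.* c) b)
  where
  distrib : ∀ a b c → a ℕ.+ b ℕ.* suc c ≡ a ℕ.+ b ℕ.* c ℕ.+ b
  distrib = ℕSolver.solve-∀

module _ (m n : ℕ) where

  Raise : Rel (Weight n m) 0ℓ
  Raise Λ Λ′ = ∃₂ λ i j → pair m n Λ i j ≡ 0ℤ × τ⁺ m n i j Λ ≡ Λ′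

  pair-translate : ∀ (Λ Λ′ : Weight n m) i j {c d} →
                   lookup (proj₁ Λ′) i ≡ lookup (proj₁ Λ) i + c →
                   lookup (proj₂ Λ′) j ≡ lookup (proj₂ Λ) j + d →
                   pair m n Λ i j ≡ 0ℤ → pair m n Λ′ i j ≡ c - d
  pair-translate (a , b) Λ′ i j {c} {d} a′ b′ p≡0 = begin
    pair m n Λ′ i j                        ≡⟨ cong₂ _-_ a′ b′ ⟩
    (lookup a i + c) - (lookup b j + d)    ≡⟨ [x+c]-[y+d]≡[x-y]+[c-d] (lookup a i) (lookup b j) c d ⟩
    (lookup a i - lookup b j) + (c - d)    ≡⟨ cong (_+ (c - d)) p≡0 ⟩
    0ℤ + (c - d)                           ≡⟨ ℤₚ.+-identityˡ (c - d) ⟩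
    c - d                                  ∎
    where open ≡-Reasoning

  τ⁻∘τ⁺ : ∀ i j (Λ : Weight n m) → τ⁻ m n i j (τ⁺ m n i j Λ) ≡ Λ
  τ⁻∘τ⁺ i j (a , b) = cong₂ _,_ (undo a i (+ n)) (undo b j (+ m))
    where
    undo : ∀ {k} (xs : Vec ℤ k) i c → updateAt (updateAt xs i (_+ c)) i (_- c) ≡ xs
    undo xs i c = trans (updateAt-updateAt-local i xs (x+c-c≡x (lookup xs i) c)) (updateAt-id i xs)
      where
      x+c-c≡x : ∀ x c → x + c - c ≡ x
      x+c-c≡x = ℤSolver.solve-∀

  𝒪-raise : ∀ {Λ Λ′} → Raise Λ Λ′ → 𝒪 m n Λ → 𝒪 m n Λ′
  𝒪-raise (i , j , p≡0 , refl) Λ∈𝒪 = up i j Λ∈𝒪 p≡0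

  𝒪-lower : ∀ {Λ Λ′} → Raise Λ Λ′ → 𝒪 m n Λ′ → 𝒪 m n Λ
  𝒪-lower {a , b} (i , j , p≡0 , refl) Λ′∈𝒪 =
    subst (𝒪 m n) (τ⁻∘τ⁺ i j (a , b))
      (down i j Λ′∈𝒪 (pair-translate (a , b) (τ⁺ m n i j (a , b)) i j (lookup∘updateAt i a) (lookup∘updateAt j b) p≡0))

  𝒪-raise* : ∀ {Λ Λ′} → Star Raise Λ Λ′ → 𝒪 m n Λ → 𝒪 m n Λ′
  𝒪-raise* ε        = id
  𝒪-raise* (r ◅ rs) = 𝒪-raise* rs ∘ 𝒪-raise r

  𝒪-lower* : ∀ {Λ Λ′} → Star Raise Λ Λ′ → 𝒪 m n Λ′ → 𝒪 m n Λ
  𝒪-lower* ε        = id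
  𝒪-lower* (r ◅ rs) = 𝒪-lower r ∘ 𝒪-lower* rs

  shift : ℤ → Weight n m → Weight n m
  shift c (a , b) = map (_+ c) a , map (_+ c) b

  shift-shift : ∀ c d (Λ : Weight n m) → shift c (shift d Λ) ≡ shift (d + c) Λ
  shift-shift c d (a , b) = cong₂ _,_ (compose a) (compose b)
    where
    compose : ∀ {k} (xs : Vec ℤ k) → map (_+ c) (map (_+ d) xs) ≡ map (_+ (d + c)) xs
    compose xs = trans (sym (map-∘ (_+ c) (_+ d) xs)) (map-cong (λ x → ℤₚ.+-assoc x d c) xs)

  shift-zero : ∀ (Λ : Weight n m) → shift 0ℤ Λ ≡ Λ
  shift-zero (a , b) = cong₂ _,_ (vanish a) (vanish b)
    where
    vanish : ∀ {k} (xs : Vec ℤ k) → map (_+ 0ℤ) xs ≡ xs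
    vanish xs = trans (map-cong ℤₚ.+-identityʳ xs) (map-id xs)

  raise-shift : ∀ c {Λ Λ′} → Raise Λ Λ′ → Raise (shift c Λ) (shift c Λ′)
  raise-shift c {a , b} (i , j , p≡0 , refl) =
    i , j ,
    trans (pair-translate (a , b) (shift c (a , b)) i j (lookup-map i (_+ c) a) (lookup-map j (_+ c) b) p≡0) (ℤₚ.+-inverseʳ c) ,
    cong₂ _,_ (sym (map-updateAt a i (+-right-comm (lookup a i) (+ n) c)))
              (sym (map-updateAt b j (+-right-comm (lookup b j) (+ m) c)))

  addBox : Vec ℕ n → Fin n → Vec ℕ n
  addBox v r = updateAt v r suc

  conj-addBox-≡ : ∀ v r j → lookup v r ≡ toℕ j → conj m n (addBox v r) j ≡ suc (conj m n v j)
  conj-addBox-≡ v r j v[r]≡j =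
    count-updateAt-enter (λ x → suc (toℕ j) ≤? x) v r
      (ℕₚ.<-irrefl (sym v[r]≡j)) (s≤s (ℕₚ.≤-reflexive (sym v[r]≡j)))

  conj-addBox-≢ : ∀ v r {j l} → lookup v r ≡ toℕ j → l ≢ j → conj m n (addBox v r) l ≡ conj m n v l
  conj-addBox-≢ v r {j} {l} v[r]≡j l≢j =
    count-updateAt-stable (λ x → suc (toℕ l) ≤? x) v r ℕₚ.m≤n⇒m≤1+n below
    where
    below : suc (toℕ l) ≤ suc (lookup v r) → suc (toℕ l) ≤ lookup v r
    below (s≤s l≤v[r]) = ℕₚ.≤∧≢⇒< l≤v[r] (λ l≡v[r] → l≢j (Finₚ.toℕ-injective (trans l≡v[r] v[r]≡j)))

  xλ-ε-opposite : ∀ v r → lookup (proj₁ (xλ m n v)) (opposite r) ≡ + (m ℕ.* toℕ r ℕ.+ n ℕ.* lookup v r)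
  xλ-ε-opposite v r =
    trans (lookup∘tabulate _ (opposite r))
          (cong₂ (λ a b → + (m ℕ.* a ℕ.+ n ℕ.* b)) toℕ-opposite (cong (lookup v) (Finₚ.opposite-involutive r)))
    where
    toℕ-opposite : n ∸ suc (toℕ (opposite r)) ≡ toℕ r
    toℕ-opposite = trans (sym (Finₚ.opposite-prop (opposite r))) (cong toℕ (Finₚ.opposite-involutive r))

  xλ-δ : ∀ v j → lookup (proj₂ (xλ m n v)) j ≡ + (n ℕ.* toℕ j ℕ.+ m ℕ.* conj m n v j)
  xλ-δ v j = lookup∘tabulate _ j

  pair-xλ-addable : ∀ v r j → lookup v r ≡ toℕ j → conj m n v j ≡ toℕ r →
                    pair m n (xλ m n v) (opposite r) j ≡ 0ℤ
  pair-xλ-addable v r j v[r]≡j conj≡r = begin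
    pair m n (xλ m n v) (opposite r) j
      ≡⟨ cong₂ _-_ (xλ-ε-opposite v r) (xλ-δ v j) ⟩
    + (m ℕ.* toℕ r ℕ.+ n ℕ.* lookup v r) - + (n ℕ.* toℕ j ℕ.+ m ℕ.* conj m n v j)
      ≡⟨ cong₂ (λ x y → + (m ℕ.* toℕ r ℕ.+ n ℕ.* x) - + (n ℕ.* toℕ j ℕ.+ m ℕ.* y)) v[r]≡j conj≡r ⟩
    + (m ℕ.* toℕ r ℕ.+ n ℕ.* toℕ j) - + (n ℕ.* toℕ j ℕ.+ m ℕ.* toℕ r)
      ≡⟨ cong (λ x → + x - + (n ℕ.* toℕ j ℕ.+ m ℕ.* toℕ r)) (ℕₚ.+-comm (m ℕ.* toℕ r) _) ⟩
    + (n ℕ.* toℕ j ℕ.+ m ℕ.* toℕ r) - + (n ℕ.* toℕ j ℕ.+ m ℕ.* toℕ r)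
      ≡⟨ ℤₚ.+-inverseʳ (+ (n ℕ.* toℕ j ℕ.+ m ℕ.* toℕ r)) ⟩
    0ℤ ∎
    where open ≡-Reasoning

  xλ-ε-addBox : ∀ v r → proj₁ (xλ m n (addBox v r)) ≡ updateAt (proj₁ (xλ m n v)) (opposite r) (_+ + n)
  xλ-ε-addBox v r = ≡-updateAt _ _ (opposite r) here elsewhere
    where
    open ≡-Reasoning
    w = addBox v r
    here : lookup (proj₁ (xλ m n w)) (opposite r) ≡ lookup (proj₁ (xλ m n v)) (opposite r) + + n
    here = begin
      lookup (proj₁ (xλ m n w)) (opposite r)     ≡⟨ xλ-ε-opposite w r ⟩
      + (m ℕ.* toℕ r ℕ.+ n ℕ.* lookup w r)       ≡⟨ cong (λ y → + (m ℕ.* toℕ r ℕ.+ n ℕ.* y)) (lookup∘updateAt r v) ⟩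
      + (m ℕ.* toℕ r ℕ.+ n ℕ.* suc (lookup v r)) ≡⟨ pos-+-*-suc (m ℕ.* toℕ r) n (lookup v r) ⟩
      + (m ℕ.* toℕ r ℕ.+ n ℕ.* lookup v r) + + n ≡⟨ cong (_+ + n) (xλ-ε-opposite v r) ⟨
      lookup (proj₁ (xλ m n v)) (opposite r) + + n ∎
    elsewhere : ∀ l → l ≢ opposite r → lookup (proj₁ (xλ m n w)) l ≡ lookup (proj₁ (xλ m n v)) l
    elsewhere l l≢ = trans (lookup∘tabulate _ l)
      (trans (cong (λ y → + (m ℕ.* (n ∸ suc (toℕ l)) ℕ.+ n ℕ.* y)) (lookup∘updateAt′ (opposite l) r opposite-l≢r v))
             (sym (lookup∘tabulate _ l)))
      where
      opposite-l≢r : opposite l ≢ r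
      opposite-l≢r e = l≢ (trans (sym (Finₚ.opposite-involutive l)) (cong opposite e))

  xλ-δ-addBox : ∀ v r j → lookup v r ≡ toℕ j →
                proj₂ (xλ m n (addBox v r)) ≡ updateAt (proj₂ (xλ m n v)) j (_+ + m)
  xλ-δ-addBox v r j v[r]≡j = ≡-updateAt _ _ j here elsewhere
    where
    open ≡-Reasoning
    w = addBox v r
    here : lookup (proj₂ (xλ m n w)) j ≡ lookup (proj₂ (xλ m n v)) j + + m
    here = begin
      lookup (proj₂ (xλ m n w)) j                    ≡⟨ xλ-δ w j ⟩
      + (n ℕ.* toℕ j ℕ.+ m ℕ.* conj m n w j)         ≡⟨ cong (λ y → + (n ℕ.* toℕ j ℕ.+ m ℕ.* y)) (conj-addBox-≡ v r j v[r]≡j) ⟩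
      + (n ℕ.* toℕ j ℕ.+ m ℕ.* suc (conj m n v j))   ≡⟨ pos-+-*-suc (n ℕ.* toℕ j) m (conj m n v j) ⟩
      + (n ℕ.* toℕ j ℕ.+ m ℕ.* conj m n v j) + + m   ≡⟨ cong (_+ + m) (xλ-δ v j) ⟨
      lookup (proj₂ (xλ m n v)) j + + m ∎
    elsewhere : ∀ l → l ≢ j → lookup (proj₂ (xλ m n w)) l ≡ lookup (proj₂ (xλ m n v)) l
    elsewhere l l≢j = trans (xλ-δ w l)
      (trans (cong (λ y → + (n ℕ.* toℕ l ℕ.+ m ℕ.* y)) (conj-addBox-≢ v r v[r]≡j l≢j)) (sym (xλ-δ v l)))

  raise-addBox : ∀ v r j → lookup v r ≡ toℕ j → conj m n v j ≡ toℕ r →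
                 Raise (xλ m n v) (xλ m n (addBox v r))
  raise-addBox v r j v[r]≡j conj≡r =
    opposite r , j , pair-xλ-addable v r j v[r]≡j conj≡r ,
    cong₂ _,_ (sym (xλ-ε-addBox v r)) (sym (xλ-δ-addBox v r j v[r]≡j))

  xλ-empty : ∀ v → (∀ k → lookup v k ≡ 0) → xλ m n v ≡ Λ₀ m n
  xλ-empty v v≡0 = cong₂ _,_ (tabulate-cong ε-coord) (tabulate-cong δ-coord)
    where
    drop-zero : ∀ a b {y} → y ≡ 0 → + (a ℕ.+ b ℕ.* y) ≡ + a
    drop-zero a b refl = cong +_ (trans (cong (a ℕ.+_) (ℕₚ.*-zeroʳ b)) (ℕₚ.+-identityʳ a))
    ε-coord : ∀ i → + (m ℕ.* (n ∸ suc (toℕ i)) ℕ.+ n ℕ.* lookup v (opposite i)) ≡ + (m ℕ.* (n ∸ suc (toℕ i)))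
    ε-coord i = drop-zero _ n (v≡0 (opposite i))
    δ-coord : ∀ j → + (n ℕ.* toℕ j ℕ.+ m ℕ.* conj m n v j) ≡ + (n ℕ.* toℕ j)
    δ-coord j = drop-zero _ m (count-prefix (λ x → suc (toℕ j) ≤? x) v z≤n
      (λ i j<v[i] → contradiction (subst (suc (toℕ j) ≤_) (v≡0 i) j<v[i]) λ ())
      (λ _ ()))

  xλ-full : xλ m n (replicate n m) ≡ shift (+ n * + m) (Λ₀ m n)
  xλ-full = cong₂ _,_
    (trans (tabulate-cong ε-coord) (tabulate-∘ (_+ + n * + m) _))
    (trans (tabulate-cong δ-coord) (tabulate-∘ (_+ + n * + m) _))
    where
    pos-+-* : ∀ a b c → + (a ℕ.+ b ℕ.* c) ≡ + a + + b * + c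
    pos-+-* a b c = trans (ℤₚ.pos-+ a (b ℕ.* c)) (cong (_+_ (+ a)) (ℤₚ.pos-* b c))
    ε-coord : ∀ i → + (m ℕ.* (n ∸ suc (toℕ i)) ℕ.+ n ℕ.* lookup (replicate n m) (opposite i))
                  ≡ + (m ℕ.* (n ∸ suc (toℕ i))) + + n * + m
    ε-coord i = trans (cong (λ y → + (m ℕ.* (n ∸ suc (toℕ i)) ℕ.+ n ℕ.* y)) (lookup-replicate (opposite i) m))
                      (pos-+-* _ n m)
    δ-coord : ∀ j → + (n ℕ.* toℕ j ℕ.+ m ℕ.* conj m n (replicate n m) j) ≡ + (n ℕ.* toℕ j) + + n * + m
    δ-coord j = trans (cong (λ y → + (n ℕ.* toℕ j ℕ.+ y)) (trans (cong (m ℕ.*_) conj≡n) (ℕₚ.*-comm m n)))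
                      (pos-+-* _ n m)
      where
      conj≡n : conj m n (replicate n m) j ≡ n
      conj≡n = count-prefix (λ x → suc (toℕ j) ≤? x) (replicate n m) ℕₚ.≤-refl
        (λ i _ → Finₚ.toℕ<n i)
        (λ i _ → subst (suc (toℕ j) ≤_) (sym (lookup-replicate i m)) (Finₚ.toℕ<n j))

  replicate∈X : InX m n (replicate n m)
  replicate∈X = record
    { decreasing = λ i k _ → ℕₚ.≤-reflexive (trans (lookup-replicate k m) (sym (lookup-replicate i m)))
    ; bounded    = λ i → ℕₚ.≤-reflexive (lookup-replicate i m)
    }

  module _ (λs : Vec ℕ n) (λ∈X : InX m n λs) where
    open InX λ∈X

    -- Row k of λ filled up to row r, which holds only c boxes; rows below r are empty.
    filledEntry : ℕ → ℕ → Fin n → ℕ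
    filledEntry r c k with ℕₚ.<-cmp (toℕ k) r
    ... | tri< _ _ _ = lookup λs k
    ... | tri≈ _ _ _ = c
    ... | tri> _ _ _ = 0

    filled : ℕ → ℕ → Vec ℕ n
    filled r c = tabulate (filledEntry r c)

    filledEntry-here : ∀ r c k → toℕ k ≡ r → filledEntry r c k ≡ c
    filledEntry-here r c k k≡r with ℕₚ.<-cmp (toℕ k) r
    ... | tri< _ k≢r _ = contradiction k≡r k≢r
    ... | tri≈ _ _ _   = refl
    ... | tri> _ k≢r _ = contradiction k≡r k≢r

    filledEntry-elsewhere : ∀ r c c′ k → toℕ k ≢ r → filledEntry r c k ≡ filledEntry r c′ k
    filledEntry-elsewhere r c c′ k k≢r with ℕₚ.<-cmp (toℕ k) r
    ... | tri< _ _ _   = refl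
    ... | tri≈ _ k≡r _ = contradiction k≡r k≢r
    ... | tri> _ _ _   = refl

    lookup-filled-here : ∀ (r : Fin n) c → lookup (filled (toℕ r) c) r ≡ c
    lookup-filled-here r c = trans (lookup∘tabulate _ r) (filledEntry-here (toℕ r) c r refl)

    filled-addBox : ∀ (r : Fin n) c → filled (toℕ r) (suc c) ≡ addBox (filled (toℕ r) c) r
    filled-addBox r c = ≡-updateAt _ _ r
      (trans (lookup-filled-here r (suc c)) (cong suc (sym (lookup-filled-here r c))))
      (λ l l≢r → trans (lookup∘tabulate _ l)
                       (trans (filledEntry-elsewhere (toℕ r) (suc c) c l (l≢r ∘ Finₚ.toℕ-injective))
                              (sym (lookup∘tabulate _ l))))

    conj-filled : ∀ (r : Fin n) (j : Fin m) → toℕ j < lookup λs r →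
                  conj m n (filled (toℕ r) (toℕ j)) j ≡ toℕ r
    conj-filled r j j<λr =
      count-prefix (λ x → suc (toℕ j) ≤? x) (filled (toℕ r) (toℕ j)) (ℕₚ.<⇒≤ (Finₚ.toℕ<n r)) only above
      where
      only : ∀ i → toℕ j < lookup (filled (toℕ r) (toℕ j)) i → toℕ i < toℕ r
      only i rewrite lookup∘tabulate (filledEntry (toℕ r) (toℕ j)) i with ℕₚ.<-cmp (toℕ i) (toℕ r)
      ... | tri< i<r _ _ = λ _ → i<r
      ... | tri≈ _ _ _   = λ j<j → contradiction j<j (ℕₚ.<-irrefl refl)
      ... | tri> _ _ _   = λ ()
      above : ∀ i → toℕ i < toℕ r → toℕ j < lookup (filled (toℕ r) (toℕ j)) i
      above i i<r rewrite lookup∘tabulate (filledEntry (toℕ r) (toℕ j)) i with ℕₚ.<-cmp (toℕ i) (toℕ r)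
      ... | tri< _ _ _   = ℕₚ.<-≤-trans j<λr (decreasing i r (ℕₚ.<⇒≤ i<r))
      ... | tri≈ i≮r _ _ = contradiction i<r i≮r
      ... | tri> i≮r _ _ = contradiction i<r i≮r

    filled-next-row : ∀ (r : Fin n) → filled (toℕ r) (lookup λs r) ≡ filled (suc (toℕ r)) 0
    filled-next-row r = tabulate-cong entry
      where
      entry : ∀ k → filledEntry (toℕ r) (lookup λs r) k ≡ filledEntry (suc (toℕ r)) 0 k
      entry k with ℕₚ.<-cmp (toℕ k) (toℕ r) | ℕₚ.<-cmp (toℕ k) (suc (toℕ r))
      ... | tri< _ _ _   | tri< _ _ _      = refl
      ... | tri≈ _ k≡r _ | tri< _ _ _      = cong (lookup λs) (Finₚ.toℕ-injective (sym k≡r))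
      ... | tri> _ _ _   | tri≈ _ _ _      = refl
      ... | tri> _ _ _   | tri> _ _ _      = refl
      ... | tri< k<r _ _ | tri≈ k≮1+r _ _  = contradiction (ℕₚ.m<n⇒m<1+n k<r) k≮1+r
      ... | tri< k<r _ _ | tri> k≮1+r _ _  = contradiction (ℕₚ.m<n⇒m<1+n k<r) k≮1+r
      ... | tri≈ _ k≡r _ | tri≈ k≮1+r _ _  = contradiction (s≤s (ℕₚ.≤-reflexive k≡r)) k≮1+r
      ... | tri≈ _ k≡r _ | tri> k≮1+r _ _  = contradiction (s≤s (ℕₚ.≤-reflexive k≡r)) k≮1+r
      ... | tri> _ _ r<k | tri< k<1+r _ _  = contradiction (ℕₚ.≤-pred k<1+r) (ℕₚ.<⇒≱ r<k)

    filled-empty : ∀ k → lookup (filled 0 0) k ≡ 0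
    filled-empty k rewrite lookup∘tabulate (filledEntry 0 0) k with ℕₚ.<-cmp (toℕ k) 0
    ... | tri≈ _ _ _ = refl
    ... | tri> _ _ _ = refl

    filled-full : filled n 0 ≡ λs
    filled-full = trans (tabulate-cong entry) (tabulate∘lookup λs)
      where
      entry : ∀ k → filledEntry n 0 k ≡ lookup λs k
      entry k with ℕₚ.<-cmp (toℕ k) n
      ... | tri< _ _ _   = refl
      ... | tri≈ k≮n _ _ = contradiction (Finₚ.toℕ<n k) k≮n
      ... | tri> k≮n _ _ = contradiction (Finₚ.toℕ<n k) k≮n

    raise-fillBox : ∀ (r : Fin n) (j : Fin m) → toℕ j < lookup λs r →
                    Raise (xλ m n (filled (toℕ r) (toℕ j))) (xλ m n (filled (toℕ r) (suc (toℕ j))))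
    raise-fillBox r j j<λr =
      subst (Raise _) (cong (xλ m n) (sym (filled-addBox r (toℕ j))))
        (raise-addBox (filled (toℕ r) (toℕ j)) r j (lookup-filled-here r (toℕ j)) (conj-filled r j j<λr))

    raise*-fillRow : ∀ (r : Fin n) c → c ≤ lookup λs r →
                     Star Raise (xλ m n (filled (toℕ r) 0)) (xλ m n (filled (toℕ r) c))
    raise*-fillRow r zero    _    = ε
    raise*-fillRow r (suc c) c<λr =
      raise*-fillRow r c (ℕₚ.<⇒≤ c<λr) ◅◅
      subst (λ c → Raise (xλ m n (filled (toℕ r) c)) (xλ m n (filled (toℕ r) (suc c))))
            (Finₚ.toℕ-fromℕ< c<m) (raise-fillBox r (Fin.fromℕ< c<m) j<λr) ◅ ε
      where
      c<m : c < m
      c<m = ℕₚ.<-≤-trans c<λr (bounded r)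
      j<λr : toℕ (Fin.fromℕ< c<m) < lookup λs r
      j<λr = subst (_< lookup λs r) (sym (Finₚ.toℕ-fromℕ< c<m)) c<λr

    raise*-nextRow : ∀ (r : Fin n) → Star Raise (xλ m n (filled (toℕ r) 0)) (xλ m n (filled (suc (toℕ r)) 0))
    raise*-nextRow r = subst (Star Raise _) (cong (xλ m n) (filled-next-row r)) (raise*-fillRow r _ ℕₚ.≤-refl)

    raise*-fillRows : ∀ r → r ≤ n → Star Raise (Λ₀ m n) (xλ m n (filled r 0))
    raise*-fillRows zero    _   = subst (λ Λ → Star Raise Λ (xλ m n (filled 0 0))) (xλ-empty (filled 0 0) filled-empty) ε
    raise*-fillRows (suc r) r<n =
      raise*-fillRows r (ℕₚ.<⇒≤ r<n) ◅◅
      subst (λ r → Star Raise (xλ m n (filled r 0)) (xλ m n (filled (suc r) 0)))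
            (Finₚ.toℕ-fromℕ< r<n) (raise*-nextRow (Fin.fromℕ< r<n))

    raise*-xλ : Star Raise (Λ₀ m n) (xλ m n λs)
    raise*-xλ = subst (Star Raise (Λ₀ m n)) (cong (xλ m n) filled-full) (raise*-fillRows n ℕₚ.≤-refl)

  raise*-period : ∀ k → Star Raise (shiftΛ₀ m n k) (shiftΛ₀ m n (ℤ.suc k))
  raise*-period k =
    subst (Star Raise (shiftΛ₀ m n k))
          (trans (shift-shift c (+ n * + m) (Λ₀ m n)) (cong (λ d → shift d (Λ₀ m n)) (period-shift k (+ n) (+ m))))
          (Star.gmap (shift c) (raise-shift c) box)
    where
    c = k * + n * + m
    box : Star Raise (Λ₀ m n) (shift (+ n * + m) (Λ₀ m n))
    box = subst (Star Raise (Λ₀ m n)) xλ-full (raise*-xλ (replicate n m) replicate∈X)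
    period-shift : ∀ k a b → a * b + k * a * b ≡ (1ℤ + k) * a * b
    period-shift = ℤSolver.solve-∀

  𝒪-shiftΛ₀ : ∀ k → 𝒪 m n (shiftΛ₀ m n k)
  𝒪-shiftΛ₀ = ℤ-bi-induction (𝒪 m n ∘ shiftΛ₀ m n)
    (subst (𝒪 m n) (sym (shift-zero (Λ₀ m n))) base)
    (λ k → 𝒪-raise* (raise*-period k))
    (λ k → 𝒪-lower* (raise*-period k))

corollary4p4 : (m n : ℕ) → 0 < n → n < m →
    (∀ (λs : Vec ℕ n) → InX m n λs → 𝒪 m n (xλ m n λs))
    × (∀ (k : ℤ) → 𝒪 m n (shiftΛ₀ m n k))
corollary4p4 m n _ _ =
  (λ λs λ∈X → 𝒪-raise* m n (raise*-xλ m n λs λ∈X) base) , 𝒪-shiftΛ₀ m n
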